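{- Let $G$ be a bipartite graph without isolated vertices, of order $n \geq 6$, with domination number $\gamma(G)=2$, and having exactly one minimum dominating set. Then the number of edges of $G$ satisfies $$s(G) \leq \begin{cases} \frac{n(n-2)}{4}, & \text{if } n \text{ is even},\\[2pt] \frac{(n-1)^2}{4}, & \text{if } n \text{ is odd.}\end{cases}$$
   Context: All graphs are finite and simple. A dominating set of a graph $G=(V,E)$ is a set $D\subseteq V$ such that every vertex of $V\setminus D$ is adjacent to some vertex of $D$; the domination number $\gamma(G)$ is the minimum size of a dominating set, and a minimum dominating set is a dominating set of size $\gamma(G)$. $s(G)$ denotes the number of edges of $G$. -}

module Defs where

open import Data.Nat using (ℕ; _<ᵇ_; _+_; _≤_)
open import Data.Bool using (Bool; true; false; _∧_; if_then_else_)
open import Data.Fin using (Fin; toℕ)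
open import Data.Fin.Subset using (Subset; _∈_; ∣_∣)
open import Data.List using (List; map; allFin)
open import Data.Nat.ListAction using (sum)
open import Data.Product using (Σ; ∃; _×_)
open import Data.Sum using (_⊎_)
open import Relation.Binary.PropositionalEquality using (_≡_; _≢_)

record Graph (n : ℕ) : Set where
  field
    adj   : Fin n → Fin n → Bool
    sym   : ∀ u v → adj u v ≡ adj v u
    irrefl : ∀ v → adj v v ≡ false
open Graph public

Adjacent : ∀ {n} → Graph n → Fin n → Fin n → Set
Adjacent G u v = adj G u v ≡ true

edgeCount : ∀ {n} → Graph n → ℕ
edgeCount {n} G =
  sum (map (λ i → sum (map (λ j → if (toℕ i <ᵇ toℕ j) ∧ adj G i j then 1 else 0)
                           (allFin n)))
           (allFin n))

Bipartite : ∀ {n} → Graph n → Set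
Bipartite {n} G = Σ (Fin n → Bool) λ c → ∀ u v → Adjacent G u v → c u ≢ c v

NoIsolated : ∀ {n} → Graph n → Set
NoIsolated {n} G = ∀ v → ∃ λ (u : Fin n) → Adjacent G v u

Dominating : ∀ {n} → Graph n → Subset n → Set
Dominating {n} G D = ∀ v → v ∈ D ⊎ (∃ λ (u : Fin n) → u ∈ D × Adjacent G u v)

MinDominating : ∀ {n} → Graph n → Subset n → Set
MinDominating {n} G D = Dominating G D × (∀ D' → Dominating G D' → ∣ D ∣ ≤ ∣ D' ∣)

DomNumber : ∀ {n} → Graph n → ℕ → Set
DomNumber {n} G k = Σ (Subset n) λ D → MinDominating G D × ∣ D ∣ ≡ k

UniqueMinDom : ∀ {n} → Graph n → Set
UniqueMinDom {n} G = Σ (Subset n) λ D → MinDominating G D × (∀ D' → MinDominating G D' → D' ≡ D)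

{-# OPTIONS --safe #-}
module Submission where

-- Let {a, b} be the unique minimum dominating set. For a colour class β, let nonEdges β be
-- the number of non-adjacent pairs (v, w) with v in β and w in the other class, so that
-- s(G) + nonEdges β = |β| (n − |β|). Uniqueness of {a, b} forces non-edges: a vertex x
-- adjacent to the whole opposite class would, together with a suitable y, form a dominating
-- pair {x, y} ≠ {a, b}. Distinguishing whether a and b have the same colour, and otherwise
-- whether they are adjacent, one finds a class β with nonEdges β ≥ |β|. Hence
-- s(G) ≤ p (q − 1) for p = |β|, q = n − p, and 4 p (q − 1) ≤ (n − 1)², strictly (so
-- 4 p (q − 1) ≤ n (n − 2)) when n is even, because then p ≠ q − 1.

open import Data.Nat.Properties
  using ( module ≤-Reasoning; +-*-semiring; ≤-refl; ≤-reflexive; ≤-trans; ≤-total; ≤-antisym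
        ; ≤-pred; ≤-<-trans; <-≤-trans; <-asym; ≮⇒≥; n≮0; n≤1+n; m≤m+n; m<m+n; suc-injective
        ; +-comm; +-suc; +-identityʳ; +-mono-≤; +-monoʳ-≤; +-cancelʳ-≤; *-comm; *-suc; *-zeroʳ
        ; *-identityˡ; *-identityʳ; *-distribˡ-+; *-distribʳ-+; *-monoʳ-≤; *-cancelˡ-≡
        ; m+[n∸m]≡n; ∣m-m+n∣≡n; ∣m-n∣≡0⇒m≡n; ∣-∣-comm; <ᵇ-reflects-< )
open import Algebra.Properties.Semiring.Sum +-*-semiring
  using (sum; sum-syntax; ∑-distrib-+; ∑-comm; sum-cong-≗; sum-replicate-zero; *-distribˡ-sum; *-distribʳ-sum)
open import Data.Bool using (Bool; true; false; not; _∧_; if_then_else_)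
open import Data.Bool.Properties using (¬-not) renaming (_≟_ to _≟ᵇ_)
open import Data.Fin using (Fin; zero; suc; toℕ; punchIn; punchOut)
open import Data.Fin.Properties
  using (toℕ-injective; _≟_; any?; punchInᵢ≢i; punchIn-injective; punchIn-punchOut)
open import Data.Fin.Subset using (Subset; inside; outside; _∈_; _∉_; ∣_∣; ⁅_⁆; _∪_)
open import Data.Fin.Subset.Properties using (x∈p⇒∣p-x∣<∣p∣; x∈⁅x⁆; x∈p∪q⁺; ∣⁅x⁆∣≡1)
open import Data.Vec using (_∷_; []; here; there)
open import Data.List using (allFin; tabulate; map)
open import Data.List.Properties using (map-tabulate)
open import Data.Nat using (ℕ; _<ᵇ_; zero; suc; _+_; _*_; _∸_; _%_; _≤_; _<_; ∣_-_∣; z≤n; s≤s)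
open import Data.Nat.ListAction as List using ()
open import Data.Nat.Tactic.RingSolver using (solve-∀)
open import Data.Product using (_×_; _,_; ∃; ∃₂; proj₂)
open import Data.Sum as Sum using (_⊎_; inj₁; inj₂)
open import Function using (_∘_)
open import Relation.Nullary using (¬_; Dec; yes; no; does; ofʸ; ofⁿ; ¬?; contradiction)
open import Relation.Nullary.Decidable using (_×-dec_; decidable-stable)
open import Relation.Binary.PropositionalEquality

open import Defs renaming (sym to adj-sym; irrefl to adj-irrefl)

-- Written with if_then_else_ so that it is literally the summand of edgeCount.
χ : Bool → ℕ
χ b = if b then 1 else 0

χ≤1 : ∀ b → χ b ≤ 1
χ≤1 true  = ≤-refl
χ≤1 false = z≤n

δ : ∀ {n} → Fin n → Fin n → ℕ
δ a v = χ (does (a ≟ v))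

∑-mono : ∀ {n} {f g : Fin n → ℕ} → (∀ i → f i ≤ g i) → sum f ≤ sum g
∑-mono {zero}  f≤g = z≤n
∑-mono {suc n} f≤g = +-mono-≤ (f≤g zero) (∑-mono (f≤g ∘ suc))

∑-δ : ∀ {n} (a : Fin n) → ∑[ v < n ] δ a v ≡ 1
∑-δ {suc n} zero    = cong suc (sum-replicate-zero n)
∑-δ {suc n} (suc a) = ∑-δ a

∑-ones : ∀ n → ∑[ v < n ] 1 ≡ n
∑-ones zero    = refl
∑-ones (suc n) = cong suc (∑-ones n)

sum-allFin : ∀ {n} (f : Fin n → ℕ) → List.sum (map f (allFin n)) ≡ sum f
sum-allFin {n} f = trans (cong List.sum (map-tabulate (λ i → i) f)) (sum-tabulate f)
  where
  sum-tabulate : ∀ {m} (g : Fin m → ℕ) → List.sum (tabulate g) ≡ sum g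
  sum-tabulate {zero}  g = refl
  sum-tabulate {suc m} g = cong (g zero +_) (sum-tabulate (g ∘ suc))

EdgeBound : ℕ → ℕ → Set
EdgeBound n e = (n % 2 ≡ 0 → 4 * e ≤ n * (n ∸ 2)) × (¬ (n % 2 ≡ 0) → 4 * e ≤ (n ∸ 1) * (n ∸ 1))

square-sum≡-ordered : ∀ {a b} → a ≤ b → (a + b) * (a + b) ≡ 4 * (a * b) + ∣ a - b ∣ * ∣ a - b ∣
square-sum≡-ordered {a} {b} a≤b =
  subst (λ b → (a + b) * (a + b) ≡ 4 * (a * b) + ∣ a - b ∣ * ∣ a - b ∣)
        (m+[n∸m]≡n a≤b) (shifted (b ∸ a))
  where
  identity : ∀ a d → (a + (a + d)) * (a + (a + d)) ≡ 4 * (a * (a + d)) + d * d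
  identity = solve-∀
  shifted : ∀ d → (a + (a + d)) * (a + (a + d)) ≡ 4 * (a * (a + d)) + ∣ a - a + d ∣ * ∣ a - a + d ∣
  shifted d rewrite ∣m-m+n∣≡n a d = identity a d

square-sum≡ : ∀ a b → (a + b) * (a + b) ≡ 4 * (a * b) + ∣ a - b ∣ * ∣ a - b ∣
square-sum≡ a b with ≤-total a b
... | inj₁ a≤b = square-sum≡-ordered a≤b
... | inj₂ b≤a = begin
  (a + b) * (a + b)                    ≡⟨ cong₂ _*_ (+-comm a b) (+-comm a b) ⟩
  (b + a) * (b + a)                    ≡⟨ square-sum≡-ordered b≤a ⟩
  4 * (b * a) + ∣ b - a ∣ * ∣ b - a ∣  ≡⟨ cong₂ (λ x y → 4 * x + y * y) (*-comm b a) (∣-∣-comm b a) ⟩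
  4 * (a * b) + ∣ a - b ∣ * ∣ a - b ∣  ∎
  where open ≡-Reasoning

four-mul≤square-sum : ∀ a b → 4 * (a * b) ≤ (a + b) * (a + b)
four-mul≤square-sum a b = ≤-trans (m≤m+n _ _) (≤-reflexive (sym (square-sum≡ a b)))

four-mul<square-sum : ∀ {a b} → a ≢ b → 4 * (a * b) < (a + b) * (a + b)
four-mul<square-sum {a} {b} a≢b with ∣ a - b ∣ in a-b | square-sum≡ a b
... | zero  | _  = contradiction (∣m-n∣≡0⇒m≡n a-b) a≢b
... | suc d | eq = subst (4 * (a * b) <_) (sym eq) (m<m+n _ (s≤s z≤n))

<-square⇒≤-suc*pred : ∀ {m} s → m < s * s → m ≤ suc s * (s ∸ 1)
<-square⇒≤-suc*pred {m} (suc t) m<s² = ≤-pred (subst (m <_) (square-suc t) m<s²)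
  where
  square-suc : ∀ t → suc t * suc t ≡ suc (suc (suc t) * t)
  square-suc = solve-∀

odd-%2 : ∀ m → suc (m + m) % 2 ≡ 1
odd-%2 zero    = refl
odd-%2 (suc m) rewrite +-suc m m = odd-%2 m

e+p≤p*q⇒EdgeBound : ∀ p q e → e + p ≤ p * q → EdgeBound (p + q) e
e+p≤p*q⇒EdgeBound p zero e e+p≤0 = (λ _ → 4e≤) , (λ _ → 4e≤)
  where
  4e≤ : ∀ {x} → 4 * e ≤ x
  4e≤ = ≤-trans (*-monoʳ-≤ 4 (≤-trans (m≤m+n e p) (≤-trans e+p≤0 (≤-reflexive (*-zeroʳ p))))) z≤n
e+p≤p*q⇒EdgeBound p (suc b) e e+p≤ rewrite +-suc p b = even , odd
  where
  e≤pb : e ≤ p * b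
  e≤pb = +-cancelʳ-≤ p e (p * b) (subst (e + p ≤_) (trans (*-suc p b) (+-comm p (p * b))) e+p≤)

  even : suc (p + b) % 2 ≡ 0 → 4 * e ≤ suc (p + b) * (p + b ∸ 1)
  even n-even = <-square⇒≤-suc*pred (p + b) (≤-<-trans (*-monoʳ-≤ 4 e≤pb) (four-mul<square-sum p≢b))
    where
    p≢b : p ≢ b
    p≢b refl = contradiction (trans (sym (odd-%2 p)) n-even) λ ()

  odd : ¬ (suc (p + b) % 2 ≡ 0) → 4 * e ≤ (p + b) * (p + b)
  odd _ = ≤-trans (*-monoʳ-≤ 4 e≤pb) (four-mul≤square-sum p b)

both≢⇒≡ : ∀ {x y z : Bool} → x ≢ z → y ≢ z → x ≡ y
both≢⇒≡ x≢z y≢z = trans (¬-not x≢z) (sym (¬-not y≢z))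

third-vertex : ∀ {n} → 3 ≤ n → (a b : Fin n) → ∃ λ v → v ≢ a × v ≢ b
third-vertex (s≤s (s≤s (s≤s _))) a b with a ≟ b
... | yes refl = punchIn a zero , punchInᵢ≢i a zero , punchInᵢ≢i a zero
... | no a≢b   = punchIn a (punchIn b′ zero) , punchInᵢ≢i a _ , v≢b
  where
  b′ = punchOut a≢b
  v≢b : punchIn a (punchIn b′ zero) ≢ b
  v≢b v≡b = punchInᵢ≢i b′ zero (punchIn-injective a _ _ (trans v≡b (sym (punchIn-punchOut a≢b))))

∣p∪q∣≤∣p∣+∣q∣ : ∀ {n} (p q : Subset n) → ∣ p ∪ q ∣ ≤ ∣ p ∣ + ∣ q ∣
∣p∪q∣≤∣p∣+∣q∣ []            []            = z≤n
∣p∪q∣≤∣p∣+∣q∣ (inside ∷ p)  (inside ∷ q)  =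
  s≤s (≤-trans (∣p∪q∣≤∣p∣+∣q∣ p q) (≤-trans (n≤1+n _) (≤-reflexive (sym (+-suc ∣ p ∣ ∣ q ∣)))))
∣p∪q∣≤∣p∣+∣q∣ (inside ∷ p)  (outside ∷ q) = s≤s (∣p∪q∣≤∣p∣+∣q∣ p q)
∣p∪q∣≤∣p∣+∣q∣ (outside ∷ p) (inside ∷ q)  =
  ≤-trans (s≤s (∣p∪q∣≤∣p∣+∣q∣ p q)) (≤-reflexive (sym (+-suc ∣ p ∣ ∣ q ∣)))
∣p∪q∣≤∣p∣+∣q∣ (outside ∷ p) (outside ∷ q) = ∣p∪q∣≤∣p∣+∣q∣ p q

∣p∣≡0⇒x∉p : ∀ {n} {p : Subset n} {x} → ∣ p ∣ ≡ 0 → x ∉ p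
∣p∣≡0⇒x∉p ∣p∣≡0 x∈p = n≮0 (<-≤-trans (x∈p⇒∣p-x∣<∣p∣ x∈p) (≤-reflexive ∣p∣≡0))

∣p∣≡1⇒singleton : ∀ {n} (p : Subset n) → ∣ p ∣ ≡ 1 → ∃ λ a → ∀ {v} → v ∈ p → v ≡ a
∣p∣≡1⇒singleton (inside ∷ p)  ∣p∣≡1 = zero , λ
  { here        → refl
  ; (there v∈p) → contradiction v∈p (∣p∣≡0⇒x∉p (suc-injective ∣p∣≡1)) }
∣p∣≡1⇒singleton (outside ∷ p) ∣p∣≡1 with ∣p∣≡1⇒singleton p ∣p∣≡1
... | a , p⊆a = suc a , λ { (there v∈p) → cong suc (p⊆a v∈p) }

∣p∣≡2⇒pair : ∀ {n} (p : Subset n) → ∣ p ∣ ≡ 2 → ∃₂ λ a b → ∀ {v} → v ∈ p → v ≡ a ⊎ v ≡ b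
∣p∣≡2⇒pair (inside ∷ p)  ∣p∣≡2 with ∣p∣≡1⇒singleton p (suc-injective ∣p∣≡2)
... | b , p⊆b = zero , suc b , λ
  { here        → inj₁ refl
  ; (there v∈p) → inj₂ (cong suc (p⊆b v∈p)) }
∣p∣≡2⇒pair (outside ∷ p) ∣p∣≡2 with ∣p∣≡2⇒pair p ∣p∣≡2
... | a , b , p⊆ab = suc a , suc b , λ { (there v∈p) → Sum.map (cong suc) (cong suc) (p⊆ab v∈p) }

module _ {n} (G : Graph n) where

  deg : Fin n → ℕ
  deg v = ∑[ w < n ] χ (adj G v w)

  private
    ordered : Fin n → Fin n → ℕ
    ordered i j = χ ((toℕ i <ᵇ toℕ j) ∧ adj G i j)

    reversed : Fin n → Fin n → ℕ
    reversed i j = χ ((toℕ j <ᵇ toℕ i) ∧ adj G i j)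

    ∑ordered : ℕ
    ∑ordered = ∑[ i < n ] ∑[ j < n ] ordered i j

    edgeCount≡∑ordered : edgeCount G ≡ ∑ordered
    edgeCount≡∑ordered = trans (sum-allFin (λ i → List.sum (map (ordered i) (allFin n))))
                               (sum-cong-≗ (λ i → sum-allFin (ordered i)))

    ∑ordered≡∑reversed : ∑ordered ≡ ∑[ i < n ] ∑[ j < n ] reversed i j
    ∑ordered≡∑reversed = trans (∑-comm ordered)
      (sum-cong-≗ λ i → sum-cong-≗ λ j → cong (χ ∘ ((toℕ j <ᵇ toℕ i) ∧_)) (adj-sym G j i))

    ordered+reversed : ∀ i j → ordered i j + reversed i j ≡ χ (adj G i j)
    ordered+reversed i j
      with toℕ i <ᵇ toℕ j | <ᵇ-reflects-< (toℕ i) (toℕ j) | toℕ j <ᵇ toℕ i | <ᵇ-reflects-< (toℕ j) (toℕ i)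
    ... | true  | ofʸ i<j | true  | ofʸ j<i = contradiction j<i (<-asym i<j)
    ... | true  | _       | false | _       = +-identityʳ _
    ... | false | _       | true  | _       = refl
    ... | false | ofⁿ i≮j | false | ofⁿ j≮i = cong χ (sym (trans (cong (adj G i) (sym i≡j)) (adj-irrefl G i)))
      where
      i≡j : i ≡ j
      i≡j = toℕ-injective (≤-antisym (≮⇒≥ j≮i) (≮⇒≥ i≮j))

  handshake : 2 * edgeCount G ≡ ∑[ v < n ] deg v
  handshake = begin
    2 * edgeCount G                                     ≡⟨ cong (edgeCount G +_) (+-identityʳ (edgeCount G)) ⟩
    edgeCount G + edgeCount G                           ≡⟨ cong₂ _+_ edgeCount≡∑ordered
                                                                 (trans edgeCount≡∑ordered ∑ordered≡∑reversed) ⟩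
    ∑ordered + ∑[ i < n ] ∑[ j < n ] reversed i j       ≡⟨ ∑-distrib-+ (λ i → ∑[ j < n ] ordered i j) _ ⟨
    ∑[ i < n ] (sum (ordered i) + sum (reversed i))     ≡⟨ sum-cong-≗ (λ i → ∑-distrib-+ (ordered i) _) ⟨
    ∑[ i < n ] ∑[ j < n ] (ordered i j + reversed i j)  ≡⟨ sum-cong-≗ (λ i → sum-cong-≗ (ordered+reversed i)) ⟩
    ∑[ i < n ] deg i                                    ∎
    where open ≡-Reasoning

module Bipartition {n} (G : Graph n) (c : Fin n → Bool) (proper : ∀ u v → Adjacent G u v → c u ≢ c v) where

  member : Bool → Fin n → ℕ
  member β v = χ (does (c v ≟ᵇ β))

  classSize : Bool → ℕ
  classSize β = ∑[ v < n ] member β v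

  member-partition : ∀ β v → member β v + member (not β) v ≡ 1
  member-partition β v = partition (c v) β
    where
    partition : ∀ x y → χ (does (x ≟ᵇ y)) + χ (does (x ≟ᵇ not y)) ≡ 1
    partition true  true  = refl
    partition true  false = refl
    partition false true  = refl
    partition false false = refl

  classSize-partition : ∀ β → classSize β + classSize (not β) ≡ n
  classSize-partition β = begin
    classSize β + classSize (not β)          ≡⟨ ∑-distrib-+ (member β) (member (not β)) ⟨
    ∑[ v < n ] (member β v + member (not β) v) ≡⟨ sum-cong-≗ (member-partition β) ⟩
    ∑[ v < n ] 1                             ≡⟨ ∑-ones n ⟩
    n                                        ∎
    where open ≡-Reasoning

  member-self : ∀ {β v} → c v ≡ β → member β v ≡ 1
  member-self {β} {v} cv≡β with c v ≟ᵇ β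
  ... | yes _    = refl
  ... | no cv≢β = contradiction cv≡β cv≢β

  member*-colour : ∀ (f : Bool → ℕ) β v → member β v * f (c v) ≡ member β v * f β
  member*-colour f β v with c v ≟ᵇ β
  ... | yes refl = refl
  ... | no _     = refl

  member-across : ∀ β {v w} → Adjacent G v w → member (not β) v ≡ member β w
  member-across β {v} {w} vw rewrite ¬-not (proper v w vw) = does-not (c w) β
    where
    does-not : ∀ x y → χ (does (not x ≟ᵇ not y)) ≡ χ (does (x ≟ᵇ y))
    does-not true  true  = refl
    does-not true  false = refl
    does-not false true  = refl
    does-not false false = refl

  edgeCount≡∑member*deg : ∀ β → edgeCount G ≡ ∑[ v < n ] (member β v * deg G v)
  edgeCount≡∑member*deg β = *-cancelˡ-≡ _ _ 2 (begin
    2 * edgeCount G                                        ≡⟨ handshake G ⟩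
    ∑[ v < n ] deg G v                                     ≡⟨ sum-cong-≗ split ⟩
    ∑[ v < n ] (m β v * deg G v + m (not β) v * deg G v)   ≡⟨ ∑-distrib-+ (λ v → m β v * deg G v) _ ⟩
    T + ∑[ v < n ] (m (not β) v * deg G v)                 ≡⟨ cong (T +_) other-class ⟩
    T + T                                                  ≡⟨ cong (T +_) (+-identityʳ T) ⟨
    2 * T                                                  ∎)
    where
    open ≡-Reasoning
    m = member
    T = ∑[ v < n ] (m β v * deg G v)

    split : ∀ v → deg G v ≡ m β v * deg G v + m (not β) v * deg G v
    split v = begin
      deg G v                                  ≡⟨ *-identityˡ (deg G v) ⟨
      1 * deg G v                              ≡⟨ cong (_* deg G v) (member-partition β v) ⟨
      (m β v + m (not β) v) * deg G v          ≡⟨ *-distribʳ-+ (deg G v) (m β v) _ ⟩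
      m β v * deg G v + m (not β) v * deg G v  ∎

    edge-term : ∀ v w → m (not β) v * χ (adj G v w) ≡ m β w * χ (adj G v w)
    edge-term v w with adj G v w in vw
    ... | true  = cong (_* 1) (member-across β vw)
    ... | false = trans (*-zeroʳ (m (not β) v)) (sym (*-zeroʳ (m β w)))

    other-class : ∑[ v < n ] (m (not β) v * deg G v) ≡ T
    other-class = begin
      ∑[ v < n ] (m (not β) v * deg G v)
        ≡⟨ sum-cong-≗ (λ v → *-distribˡ-sum (m (not β) v) (χ ∘ adj G v)) ⟩
      ∑[ v < n ] ∑[ w < n ] (m (not β) v * χ (adj G v w)) ≡⟨ sum-cong-≗ (λ v → sum-cong-≗ (edge-term v)) ⟩
      ∑[ v < n ] ∑[ w < n ] (m β w * χ (adj G v w))     ≡⟨ ∑-comm (λ v w → m β w * χ (adj G v w)) ⟩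
      ∑[ w < n ] ∑[ v < n ] (m β w * χ (adj G v w))     ≡⟨ sum-cong-≗ (λ w → sum-cong-≗ λ v →
                                                             cong (λ x → m β w * χ x) (adj-sym G v w)) ⟩
      ∑[ w < n ] ∑[ v < n ] (m β w * χ (adj G w v))
        ≡⟨ sum-cong-≗ (λ w → *-distribˡ-sum (m β w) (χ ∘ adj G w)) ⟨
      T                                                 ∎

  NonEdge : Fin n → Fin n → Set
  NonEdge v w = c v ≢ c w × adj G v w ≡ false

  nonEdge? : ∀ v w → Dec (NonEdge v w)
  nonEdge? v w = ¬? (c v ≟ᵇ c w) ×-dec (adj G v w ≟ᵇ false)

  nonEdge-sym : ∀ {v w} → NonEdge v w → NonEdge w v
  nonEdge-sym {v} {w} (cv≢cw , vw) = cv≢cw ∘ sym , trans (adj-sym G w v) vw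

  full⇒adjacent : ∀ {v w} → ¬ ∃ (NonEdge v) → c v ≢ c w → Adjacent G v w
  full⇒adjacent {w = w} v-full cv≢cw = ¬-not λ vw → v-full (w , cv≢cw , vw)

  TwoNonEdges : Fin n → Set
  TwoNonEdges v = ∃₂ λ w w′ → w ≢ w′ × NonEdge v w × NonEdge v w′

  nonAdj : Fin n → Fin n → ℕ
  nonAdj v w = member (not (c v)) w * χ (not (adj G v w))

  nonDeg : Fin n → ℕ
  nonDeg v = ∑[ w < n ] nonAdj v w

  nonEdges : Bool → ℕ
  nonEdges β = ∑[ v < n ] (member β v * nonDeg v)

  deg+nonDeg : ∀ v → deg G v + nonDeg v ≡ classSize (not (c v))
  deg+nonDeg v = trans (sym (∑-distrib-+ (χ ∘ adj G v) _)) (sum-cong-≗ term)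
    where
    term : ∀ w → χ (adj G v w) + nonAdj v w ≡ member (not (c v)) w
    term w with adj G v w in vw
    ... | true  = trans (cong suc (*-zeroʳ (member (not (c v)) w))) (sym (member-self cw≡¬cv))
      where
      cw≡¬cv : c w ≡ not (c v)
      cw≡¬cv = ¬-not (proper w v (trans (adj-sym G w v) vw))
    ... | false = *-identityʳ (member (not (c v)) w)

  edgeCount+nonEdges : ∀ β → edgeCount G + nonEdges β ≡ classSize β * classSize (not β)
  edgeCount+nonEdges β = begin
    edgeCount G + nonEdges β                           ≡⟨ cong (_+ nonEdges β) (edgeCount≡∑member*deg β) ⟩
    ∑[ v < n ] (m β v * deg G v) + nonEdges β          ≡⟨ ∑-distrib-+ (λ v → m β v * deg G v) _ ⟨
    ∑[ v < n ] (m β v * deg G v + m β v * nonDeg v)    ≡⟨ sum-cong-≗ (λ v → *-distribˡ-+ (m β v) _ _) ⟨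
    ∑[ v < n ] (m β v * (deg G v + nonDeg v))          ≡⟨ sum-cong-≗ (λ v → cong (m β v *_) (deg+nonDeg v)) ⟩
    ∑[ v < n ] (m β v * classSize (not (c v)))         ≡⟨ sum-cong-≗ (member*-colour (classSize ∘ not) β) ⟩
    ∑[ v < n ] (m β v * classSize (not β))             ≡⟨ *-distribʳ-sum (classSize (not β)) (m β) ⟨
    classSize β * classSize (not β)                    ∎
    where
    open ≡-Reasoning
    m = member

  nonAdj-nonEdge : ∀ {v w} → NonEdge v w → nonAdj v w ≡ 1
  nonAdj-nonEdge (cv≢cw , vw) rewrite vw = trans (*-identityʳ _) (member-self (¬-not (cv≢cw ∘ sym)))

  1≤nonDeg : ∀ {v w} → NonEdge v w → 1 ≤ nonDeg v
  1≤nonDeg {v} {w} vw = subst (_≤ nonDeg v) (∑-δ w) (∑-mono point)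
    where
    point : ∀ u → δ w u ≤ nonAdj v u
    point u with w ≟ u
    ... | yes refl = ≤-reflexive (sym (nonAdj-nonEdge vw))
    ... | no _     = z≤n

  2≤nonDeg : ∀ {v} → TwoNonEdges v → 2 ≤ nonDeg v
  2≤nonDeg {v} (w , w′ , w≢w′ , vw , vw′) = begin
    2                                     ≡⟨ cong₂ _+_ (∑-δ w) (∑-δ w′) ⟨
    ∑[ u < n ] δ w u + ∑[ u < n ] δ w′ u  ≡⟨ ∑-distrib-+ (δ w) (δ w′) ⟨
    ∑[ u < n ] (δ w u + δ w′ u)           ≤⟨ ∑-mono point ⟩
    nonDeg v                              ∎
    where
    open ≤-Reasoning
    point : ∀ u → δ w u + δ w′ u ≤ nonAdj v u
    point u with w ≟ u | w′ ≟ u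
    ... | yes refl | yes refl = contradiction refl w≢w′
    ... | yes refl | no _     = ≤-reflexive (sym (nonAdj-nonEdge vw))
    ... | no _     | yes refl = ≤-reflexive (sym (nonAdj-nonEdge vw′))
    ... | no _     | no _     = z≤n

  member≤member*nonDeg : ∀ β v → (c v ≡ β → ∃ (NonEdge v)) → member β v ≤ member β v * nonDeg v
  member≤member*nonDeg β v nonEdge with c v ≟ᵇ β
  ... | yes cv≡β = subst (1 ≤_) (sym (*-identityˡ _)) (1≤nonDeg (proj₂ (nonEdge cv≡β)))
  ... | no _     = z≤n

  classSize≤nonEdges : ∀ β → (∀ v → c v ≡ β → ∃ (NonEdge v)) → classSize β ≤ nonEdges β
  classSize≤nonEdges β nonEdge = ∑-mono (λ v → member≤member*nonDeg β v (nonEdge v))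

  -- a itself may have no non-edge; the second non-edge at x makes up for it.
  classSize≤nonEdges-except : ∀ β {a x} → (∀ v → c v ≡ β → v ≢ a → ∃ (NonEdge v)) →
                              c x ≡ β → x ≢ a → TwoNonEdges x → classSize β ≤ nonEdges β
  classSize≤nonEdges-except β {a} {x} nonEdge cx≡β x≢a two = ≤-pred (begin
    1 + classSize β                             ≡⟨ cong (_+ classSize β) (∑-δ x) ⟨
    ∑[ v < n ] δ x v + classSize β              ≡⟨ ∑-distrib-+ (δ x) (member β) ⟨
    ∑[ v < n ] (δ x v + member β v)             ≤⟨ ∑-mono point ⟩
    ∑[ v < n ] (δ a v + member β v * nonDeg v)  ≡⟨ ∑-distrib-+ (δ a) _ ⟩
    ∑[ v < n ] δ a v + nonEdges β               ≡⟨ cong (_+ nonEdges β) (∑-δ a) ⟩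
    1 + nonEdges β                              ∎)
    where
    open ≤-Reasoning
    point : ∀ v → δ x v + member β v ≤ δ a v + member β v * nonDeg v
    point v with x ≟ v | a ≟ v
    ... | yes refl | yes refl = contradiction refl x≢a
    ... | yes refl | no _     rewrite member-self cx≡β | *-identityˡ (nonDeg x) = 2≤nonDeg two
    ... | no _     | yes refl = ≤-trans (χ≤1 _) (s≤s z≤n)
    ... | no _     | no a≢v   = member≤member*nonDeg β v (λ cv≡β → nonEdge v cv≡β (a≢v ∘ sym))

  classSize≤nonEdges⇒EdgeBound : ∀ β → classSize β ≤ nonEdges β → EdgeBound n (edgeCount G)
  classSize≤nonEdges⇒EdgeBound β few = subst (λ m → EdgeBound m (edgeCount G)) (classSize-partition β)
    (e+p≤p*q⇒EdgeBound (classSize β) (classSize (not β)) (edgeCount G)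
      (≤-trans (+-monoʳ-≤ (edgeCount G) few) (≤-reflexive (edgeCount+nonEdges β))))

Dominates : ∀ {n} → Graph n → Fin n → Fin n → Set
Dominates G x v = x ≡ v ⊎ Adjacent G x v

PairDominating : ∀ {n} → Graph n → Fin n → Fin n → Set
PairDominating G x y = ∀ v → Dominates G x v ⊎ Dominates G y v

record UniqueDominatingPair {n} (G : Graph n) (a b : Fin n) : Set where
  field
    dominating : PairDominating G a b
    unique     : ∀ {x y} → PairDominating G x y → x ≡ a ⊎ x ≡ b

UniqueDominatingPair-sym : ∀ {n} {G : Graph n} {a b} → UniqueDominatingPair G a b → UniqueDominatingPair G b a
UniqueDominatingPair-sym D = record
  { dominating = Sum.swap ∘ dominating
  ; unique     = Sum.swap ∘ unique
  }
  where open UniqueDominatingPair D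

module _ {n} (G : Graph n) where

  pairDominating⇒dominating : ∀ {x y} → PairDominating G x y → Dominating G (⁅ x ⁆ ∪ ⁅ y ⁆)
  pairDominating⇒dominating {x} {y} dom v with dom v
  ... | inj₁ (inj₁ refl) = inj₁ (x∈p∪q⁺ (inj₁ (x∈⁅x⁆ x)))
  ... | inj₁ (inj₂ xv)   = inj₂ (x , x∈p∪q⁺ (inj₁ (x∈⁅x⁆ x)) , xv)
  ... | inj₂ (inj₁ refl) = inj₁ (x∈p∪q⁺ (inj₂ (x∈⁅x⁆ y)))
  ... | inj₂ (inj₂ yv)   = inj₂ (y , x∈p∪q⁺ (inj₂ (x∈⁅x⁆ y)) , yv)

  unique-dominating-pair : DomNumber G 2 → UniqueMinDom G → ∃₂ (UniqueDominatingPair G)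
  unique-dominating-pair (D , (D-dom , D-min) , ∣D∣≡2) (_ , _ , minimum-unique) with ∣p∣≡2⇒pair D ∣D∣≡2
  ... | a , b , D⊆ab = a , b , record { dominating = dominating ; unique = unique }
    where
    dominating : PairDominating G a b
    dominating v with D-dom v
    ... | inj₁ v∈D = Sum.map (inj₁ ∘ sym) (inj₁ ∘ sym) (D⊆ab v∈D)
    ... | inj₂ (u , u∈D , uv) with D⊆ab u∈D
    ...   | inj₁ refl = inj₁ (inj₂ uv)
    ...   | inj₂ refl = inj₂ (inj₂ uv)

    unique : ∀ {x y} → PairDominating G x y → x ≡ a ⊎ x ≡ b
    unique {x} {y} dom = D⊆ab (subst (x ∈_) pair≡D (x∈p∪q⁺ (inj₁ (x∈⁅x⁆ x))))
      where
      ∣pair∣≤2 : ∣ ⁅ x ⁆ ∪ ⁅ y ⁆ ∣ ≤ 2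
      ∣pair∣≤2 = ≤-trans (∣p∪q∣≤∣p∣+∣q∣ ⁅ x ⁆ ⁅ y ⁆)
                         (≤-reflexive (cong₂ _+_ (∣⁅x⁆∣≡1 x) (∣⁅x⁆∣≡1 y)))
      pair-min : MinDominating G (⁅ x ⁆ ∪ ⁅ y ⁆)
      pair-min = pairDominating⇒dominating dom ,
                 λ D′ D′-dom → ≤-trans ∣pair∣≤2 (subst (_≤ ∣ D′ ∣) ∣D∣≡2 (D-min D′ D′-dom))
      pair≡D : ⁅ x ⁆ ∪ ⁅ y ⁆ ≡ D
      pair≡D = trans (minimum-unique _ pair-min) (sym (minimum-unique D (D-dom , D-min)))

module DominatingPairs {n} (G : Graph n) (c : Fin n → Bool) (proper : ∀ u v → Adjacent G u v → c u ≢ c v) where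

  open Bipartition G c proper

  pair-dominating : ∀ {x y} → c x ≢ c y →
                    (∀ v → c x ≢ c v → v ≢ y → Adjacent G x v) →
                    (∀ v → c y ≢ c v → v ≢ x → Adjacent G y v) → PairDominating G x y
  pair-dominating {x} {y} cx≢cy x-side y-side v with x ≟ v | y ≟ v | c x ≟ᵇ c v
  ... | yes x≡v | _       | _         = inj₁ (inj₁ x≡v)
  ... | no _    | yes y≡v | _         = inj₂ (inj₁ y≡v)
  ... | no _    | no y≢v  | no cx≢cv  = inj₁ (inj₂ (x-side v cx≢cv (y≢v ∘ sym)))
  ... | no x≢v  | no _    | yes cx≡cv =
    inj₂ (inj₂ (y-side v (λ cy≡cv → cx≢cy (trans cx≡cv (sym cy≡cv))) (x≢v ∘ sym)))

  module Opposite {a b} (D : UniqueDominatingPair G a b) (ca≢cb : c a ≢ c b) where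

    open UniqueDominatingPair D

    outside-pair : ∀ {x} → c x ≡ c a → x ≢ a → ¬ (x ≡ a ⊎ x ≡ b)
    outside-pair cx≡ca x≢a = Sum.[ x≢a , (λ x≡b → ca≢cb (trans (sym cx≡ca) (cong c x≡b))) ]

    b-adjacent : ∀ {x} → c x ≡ c a → x ≢ a → Adjacent G b x
    b-adjacent {x} cx≡ca x≢a with dominating x
    ... | inj₁ (inj₁ a≡x) = contradiction (sym a≡x) x≢a
    ... | inj₁ (inj₂ ax)  = contradiction (sym cx≡ca) (proper a x ax)
    ... | inj₂ (inj₁ b≡x) = contradiction (trans (sym cx≡ca) (cong c (sym b≡x))) ca≢cb
    ... | inj₂ (inj₂ bx)  = bx

    nonEdge-if-adjacent : Adjacent G a b → ∀ {x} → c x ≡ c a → x ≢ a → ∃ (NonEdge x)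
    nonEdge-if-adjacent ab {x} cx≡ca x≢a = decidable-stable (any? (nonEdge? x)) λ x-full →
      outside-pair cx≡ca x≢a (unique (pair-dominating (λ cx≡cb → ca≢cb (trans (sym cx≡ca) cx≡cb))
        (λ _ cx≢cv _ → full⇒adjacent x-full cx≢cv)
        (λ v cb≢cv _ → b-dominates v (both≢⇒≡ (cb≢cv ∘ sym) ca≢cb))))
      where
      b-dominates : ∀ v → c v ≡ c a → Adjacent G b v
      b-dominates v cv≡ca with a ≟ v
      ... | yes refl = trans (adj-sym G b a) ab
      ... | no a≢v   = b-adjacent cv≡ca (a≢v ∘ sym)

    two-nonEdges : Adjacent G a b → ∀ {x₀} → c x₀ ≡ c a → x₀ ≢ a →
                   TwoNonEdges x₀ ⊎ ∃ λ y → c y ≡ c b × y ≢ b × TwoNonEdges y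
    two-nonEdges ab {x₀} cx₀≡ca x₀≢a with nonEdge-if-adjacent ab cx₀≡ca x₀≢a
    ... | y₀ , x₀y₀@(cx₀≢cy₀ , x₀≁y₀)
        with any? (λ y → ¬? (y ≟ y₀) ×-dec nonEdge? x₀ y) | any? (λ x → ¬? (x ≟ x₀) ×-dec nonEdge? y₀ x)
    ... | yes (y , y≢y₀ , x₀y) | _ = inj₁ (y₀ , y , y≢y₀ ∘ sym , x₀y₀ , x₀y)
    ... | no _ | yes (x , x≢x₀ , y₀x) =
      inj₂ (y₀ , cy₀≡cb , y₀≢b , x₀ , x , x≢x₀ ∘ sym , nonEdge-sym x₀y₀ , y₀x)
      where
      cy₀≡cb : c y₀ ≡ c b
      cy₀≡cb = both≢⇒≡ (λ cy₀≡ca → cx₀≢cy₀ (trans cx₀≡ca (sym cy₀≡ca))) (ca≢cb ∘ sym)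
      y₀≢b : y₀ ≢ b
      y₀≢b refl = contradiction (trans (adj-sym G x₀ b) (b-adjacent cx₀≡ca x₀≢a))
                                (subst (_≢ true) (sym x₀≁y₀) λ ())
    ... | no only-y₀ | no only-x₀ = contradiction (unique (pair-dominating cx₀≢cy₀
            (λ v cx₀≢cv v≢y₀ → ¬-not λ x₀v → only-y₀ (v , v≢y₀ , cx₀≢cv , x₀v))
            (λ v cy₀≢cv v≢x₀ → ¬-not λ y₀v → only-x₀ (v , v≢x₀ , cy₀≢cv , y₀v))))
          (outside-pair cx₀≡ca x₀≢a)

    nonAdjacent⇒nonEdges : adj G a b ≡ false →
                           (∀ x → c x ≡ c a → ∃ (NonEdge x)) ⊎ (∀ y → c y ≡ c b → ∃ (NonEdge y))
    nonAdjacent⇒nonEdges a≁b with any? (λ x → (c x ≟ᵇ c a) ×-dec ¬? (any? (nonEdge? x)))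
    ... | no no-full =
      inj₁ λ x cx≡ca → decidable-stable (any? (nonEdge? x)) λ x-full → no-full (x , cx≡ca , x-full)
    ... | yes (x₀ , cx₀≡ca , x₀-full) = inj₂ λ y cy≡cb → decidable-stable (any? (nonEdge? y)) λ y-full →
      outside-pair cx₀≡ca x₀≢a (unique (pair-dominating (λ e → ca≢cb (trans (sym cx₀≡ca) (trans e cy≡cb)))
        (λ _ cx₀≢cv _ → full⇒adjacent x₀-full cx₀≢cv)
        (λ _ cy≢cv _ → full⇒adjacent y-full cy≢cv)))
      where
      x₀≢a : x₀ ≢ a
      x₀≢a refl = x₀-full (b , ca≢cb , a≁b)

  module Same {a b} (D : UniqueDominatingPair G a b) (ca≡cb : c a ≡ c b) (no-isolated : NoIsolated G) where

    open UniqueDominatingPair D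

    class-of-a : ∀ {v} → c v ≡ c a → v ≡ a ⊎ v ≡ b
    class-of-a {v} cv≡ca with dominating v
    ... | inj₁ (inj₁ a≡v) = inj₁ (sym a≡v)
    ... | inj₁ (inj₂ av)  = contradiction (sym cv≡ca) (proper a v av)
    ... | inj₂ (inj₁ b≡v) = inj₂ (sym b≡v)
    ... | inj₂ (inj₂ bv)  = contradiction (trans (sym ca≡cb) (sym cv≡ca)) (proper b v bv)

    a-nonEdge : ∃ (NonEdge a)
    a-nonEdge with no-isolated b
    ... | y , by = decidable-stable (any? (nonEdge? a)) λ a-full →
      Sum.[ cy≢ca ∘ cong c , (λ y≡b → cy≢ca (trans (cong c y≡b) (sym ca≡cb))) ]
        (unique (pair-dominating cy≢ca y-dominates (λ _ ca≢cv _ → full⇒adjacent a-full ca≢cv)))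
      where
      cy≢ca : c y ≢ c a
      cy≢ca cy≡ca = proper b y by (trans (sym ca≡cb) (sym cy≡ca))
      y-dominates : ∀ v → c y ≢ c v → v ≢ a → Adjacent G y v
      y-dominates v cy≢cv v≢a with class-of-a (both≢⇒≡ (cy≢cv ∘ sym) (cy≢ca ∘ sym))
      ... | inj₁ v≡a  = contradiction v≡a v≢a
      ... | inj₂ refl = trans (adj-sym G y b) by

  module _ {a b} (D : UniqueDominatingPair G a b) where

    private
      D′ = UniqueDominatingPair-sym D

    enough-nonEdges-if-adjacent : c a ≢ c b → Adjacent G a b → ∀ {x₀} → c x₀ ≡ c a → x₀ ≢ a →
                                  ∃ λ β → classSize β ≤ nonEdges β
    enough-nonEdges-if-adjacent ca≢cb ab cx₀≡ca x₀≢a with Opposite.two-nonEdges D ca≢cb ab cx₀≡ca x₀≢a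
    ... | inj₁ two = c a , classSize≤nonEdges-except (c a)
            (λ _ → Opposite.nonEdge-if-adjacent D ca≢cb ab) cx₀≡ca x₀≢a two
    ... | inj₂ (y , cy≡cb , y≢b , two) = c b , classSize≤nonEdges-except (c b)
            (λ _ → Opposite.nonEdge-if-adjacent D′ (ca≢cb ∘ sym) (trans (adj-sym G b a) ab)) cy≡cb y≢b two

    class-nonEdges-if-same : c a ≡ c b → NoIsolated G → ∀ x → c x ≡ c a → ∃ (NonEdge x)
    class-nonEdges-if-same ca≡cb no-isolated x cx≡ca with Same.class-of-a D ca≡cb no-isolated cx≡ca
    ... | inj₁ refl = Same.a-nonEdge D ca≡cb no-isolated
    ... | inj₂ refl = Same.a-nonEdge D′ (sym ca≡cb) no-isolated

  class-with-enough-nonEdges : ∀ {a b} → UniqueDominatingPair G a b → 3 ≤ n → NoIsolated G →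
                               ∃ λ β → classSize β ≤ nonEdges β
  class-with-enough-nonEdges {a} {b} D 3≤n no-isolated with c a ≟ᵇ c b
  ... | yes ca≡cb = c a , classSize≤nonEdges (c a) (class-nonEdges-if-same D ca≡cb no-isolated)
  ... | no ca≢cb with adj G a b in ab
  ...   | false = Sum.[ (λ all → c a , classSize≤nonEdges (c a) all)
                      , (λ all → c b , classSize≤nonEdges (c b) all)
                      ] (Opposite.nonAdjacent⇒nonEdges D ca≢cb ab)
  ...   | true with third-vertex 3≤n a b
  ...     | v , v≢a , v≢b with c v ≟ᵇ c a
  ...       | yes cv≡ca = enough-nonEdges-if-adjacent D ca≢cb ab cv≡ca v≢a
  ...       | no cv≢ca  = enough-nonEdges-if-adjacent (UniqueDominatingPair-sym D) (ca≢cb ∘ sym)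
                            (trans (adj-sym G b a) ab) (both≢⇒≡ cv≢ca (ca≢cb ∘ sym)) v≢b

theorem2p10 : (n : ℕ) (G : Graph n) → 6 ≤ n → Bipartite G → NoIsolated G →
              DomNumber G 2 → UniqueMinDom G →
              (n % 2 ≡ 0 → 4 * edgeCount G ≤ n * (n ∸ 2)) ×
              (¬ (n % 2 ≡ 0) → 4 * edgeCount G ≤ (n ∸ 1) * (n ∸ 1))
theorem2p10 n G 6≤n (c , proper) no-isolated γ≡2 unique-minimum =
  let (_ , _ , D) = unique-dominating-pair G γ≡2 unique-minimum
      (β , few)   = DominatingPairs.class-with-enough-nonEdges G c proper D 3≤n no-isolated
  in  Bipartition.classSize≤nonEdges⇒EdgeBound G c proper β few
  where
  3≤n : 3 ≤ n
  3≤n = ≤-trans (s≤s (s≤s (s≤s z≤n))) 6≤n
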